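{- Let $q=2^r$. For every $a\in\mathbb{F}_q^*$, the Hamming weight of $d(a)\in\mathbb{F}_2^{(q-1)^2}$ is \[ w(d(a))=\frac12\left(q^2-3q+1-K_2(\lambda;a)\right). \]
   Context: $tr:\mathbb{F}_q\to\mathbb{F}_2$ is the absolute trace, $\lambda(x)=(-1)^{tr(x)}$, and $K_2(\lambda;a)=\sum_{\alpha_1,\alpha_2\in\mathbb{F}_q^*}\lambda(\alpha_1+\alpha_2+a\alpha_1^{ -1}\alpha_2^{ -1})$. Fixing an ordering of $(\mathbb{F}_q^*)^2$, $d(a)$ is the vector whose entry at the pair $(\alpha_1,\alpha_2)$ is $tr(a(\alpha_1+\alpha_2+\alpha_1^{ -1}+\alpha_2^{ -1}))$. -}

module Defs where

open import Level using (0ℓ)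
open import Data.Nat using (ℕ; zero; suc; _^_)
open import Data.Integer as ℤ using (ℤ)
open import Data.List using (List; length; filter; map; concatMap; foldr)
open import Data.List.Membership.Propositional using (_∈_)
open import Data.List.Relation.Unary.Unique.Propositional using (Unique)
open import Data.Product using (Σ; _×_; _,_)
open import Relation.Nullary using (¬_; Dec; yes; no)
open import Relation.Nullary.Decidable using (¬?)
open import Relation.Binary.PropositionalEquality using (_≡_)
open import Algebra.Structures using (IsCommutativeRing)

record FiniteField (r : ℕ) : Set₁ where
  infixl 6 _+_
  infixl 7 _*_
  field
    Carrier : Set
    _+_ _*_ : Carrier → Carrier → Carrier
    -_ : Carrier → Carrier
    0# 1# : Carrier
    isCommutativeRing : IsCommutativeRing _≡_ _+_ _*_ -_ 0# 1#
    0≢1 : ¬ (0# ≡ 1#)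
    inverse : ∀ x → ¬ (x ≡ 0#) → Σ Carrier (λ y → x * y ≡ 1#)
    _≟_ : (x y : Carrier) → Dec (x ≡ y)
    elements : List Carrier
    complete : ∀ x → x ∈ elements
    unique : Unique elements
    card : length elements ≡ 2 ^ r

  pow : Carrier → ℕ → Carrier
  pow x zero = 1#
  pow x (suc n) = x * pow x n

  inv : (x : Carrier) → ¬ (x ≡ 0#) → Carrier
  inv x nz = Σ.proj₁ (inverse x nz)
    where open Data.Product

  -- absolute trace tr(x) = x + x^2 + x^4 + ... + x^(2^(r-1)), an element of F_2 ⊆ F_q
  trAux : ℕ → Carrier → Carrier
  trAux zero x = 0#
  trAux (suc i) x = pow x (2 ^ i) + trAux i x

  tr : Carrier → Carrier
  tr = trAux r

  λχ : Carrier → ℤ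
  λχ x with tr x ≟ 0#
  ... | yes _ = ℤ.+ 1
  ... | no _  = ℤ.- (ℤ.+ 1)

  nonzeros : List (Σ Carrier (λ x → ¬ (x ≡ 0#)))
  nonzeros = nz elements
    where
    nz : List Carrier → List (Σ Carrier (λ x → ¬ (x ≡ 0#)))
    nz List.[] = List.[]
    nz (x List.∷ xs) with x ≟ 0#
    ... | yes _ = nz xs
    ... | no p  = (x , p) List.∷ nz xs

  pairs : List (Σ Carrier (λ x → ¬ (x ≡ 0#)) × Σ Carrier (λ x → ¬ (x ≡ 0#)))
  pairs = concatMap (λ u → map (λ v → (u , v)) nonzeros) nonzeros

  sumℤ : List ℤ → ℤ
  sumℤ = foldr ℤ._+_ (ℤ.+ 0)

  K₂ : Carrier → ℤ
  K₂ a = sumℤ (map (λ { ((α₁ , n₁) , (α₂ , n₂)) →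
           λχ (α₁ + α₂ + a * inv α₁ n₁ * inv α₂ n₂) }) pairs)

  dEntry : Carrier → (Σ Carrier (λ x → ¬ (x ≡ 0#)) × Σ Carrier (λ x → ¬ (x ≡ 0#))) → Carrier
  dEntry a ((α₁ , n₁) , (α₂ , n₂)) = tr (a * (α₁ + α₂ + inv α₁ n₁ + inv α₂ n₂))

  d : Carrier → List Carrier
  d a = map (dEntry a) pairs

  weight : List Carrier → ℕ
  weight v = length (filter (λ e → ¬? (e ≟ 0#)) v)

{-# OPTIONS --safe #-}
module Submission where

-- Counting by signs, 2 w(d(a)) = (q - 1)² - S with S = Σ_{x,y ≠ 0} λ(a(x + y + x⁻¹ + y⁻¹)).
-- Substituting y = x s turns the inner sums of S and of K₂(λ; a) into Kloosterman sums
-- K₁(β) = Σ_{w ≠ 0} λ(w + β w⁻¹): the inner sum of K₂ is K₁(a κ(s)), and that of S is K₁(a² κ(s))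
-- for s ≠ 1 but q - 1 for s = 1, where κ(s) = (1 + s)²/s. As squaring permutes F_q^*,
-- κ(s²) = κ(s)² and K₁(β²) = K₁(β) (because tr(x²) = tr(x)), the two outer sums agree except at
-- s = 1, which adds (q - 1) - K₁(0) = q to S as λ is a nontrivial character. So S = K₂(λ; a) + q.

open import Defs
open import Function using (_∘_)
open import Data.Nat as ℕ using (ℕ; zero; suc; z≤n; s≤s; _^_)
import Data.Nat.Properties as ℕ
open import Data.Integer as ℤ using (ℤ; 1ℤ; -1ℤ)
import Data.Integer.Properties as ℤ
open import Data.Integer.Tactic.RingSolver using (solve-∀)
open import Data.Bool using (if_then_else_)
open import Data.Product using (Σ; ∃; _×_; _,_; proj₁; proj₂)
open import Data.Sum using (_⊎_; inj₁; inj₂)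
open import Data.List using (List; []; _∷_; _++_; map; foldr; length; filter; concatMap)
import Data.List.Properties as List
open import Data.List.Membership.Propositional using (_∈_)
open import Data.List.Membership.Propositional.Properties using (∈-map⁺; ∈-map⁻; ∈-filter⁺; ∈-filter⁻)
open import Data.List.Membership.Propositional.Properties.WithK using (unique∧set⇒bag)
open import Data.List.Relation.Unary.All as All using (all?)
open import Data.List.Relation.Unary.All.Properties using (¬All⇒Any¬)
open import Data.List.Relation.Unary.Any as Any using (here; there)
open import Data.List.Relation.Unary.Unique.Propositional using (Unique; []; _∷_)
import Data.List.Relation.Unary.Unique.Propositional.Properties as Unique
open import Data.List.Relation.Binary.Permutation.Propositional using (_↭_; ↭⇒↭ₛ)
import Data.List.Relation.Binary.Permutation.Propositional.Properties as ↭
import Data.List.Relation.Binary.Permutation.Setoid.Properties as ↭ₛ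
open import Data.List.Relation.Binary.BagAndSetEquality using (∼bag⇒↭)
open import Function.Bundles using (mk⇔)
open import Relation.Binary.Definitions using (DecidableEquality)
open import Relation.Nullary using (¬_; yes; no; contradiction)
open import Relation.Nullary.Decidable using (¬?)
open import Relation.Binary.PropositionalEquality
  using (_≡_; _≢_; refl; sym; trans; cong; cong₂; subst; setoid; module ≡-Reasoning)
open import Algebra.Bundles using (CommutativeRing)

module _ where

  open import Data.Integer using (+_; _+_; _-_; -_; _*_)

  private
    variable
      A B : Set

  ∑ : (A → ℤ) → List A → ℤ
  ∑ f xs = foldr _+_ (+ 0) (map f xs)

  ∑-↭ : (f : A → ℤ) {xs ys : List A} → xs ↭ ys → ∑ f xs ≡ ∑ f ys
  ∑-↭ f p = ↭ₛ.foldr-commMonoid (setoid ℤ) ℤ.+-0-isCommutativeMonoid (↭⇒↭ₛ (↭.map⁺ f p))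

  ∑-map : (f : B → ℤ) (g : A → B) (xs : List A) → ∑ f (map g xs) ≡ ∑ (f ∘ g) xs
  ∑-map f g xs = cong (foldr _+_ (+ 0)) (sym (List.map-∘ xs))

  ∑-cong : {f g : A → ℤ} (xs : List A) → (∀ {x} → x ∈ xs → f x ≡ g x) → ∑ f xs ≡ ∑ g xs
  ∑-cong xs f≡g = cong (foldr _+_ (+ 0)) (List.map-cong-local (All.tabulate f≡g))

  ∑-const : (c : ℤ) (xs : List A) → ∑ (λ _ → c) xs ≡ + length xs * c
  ∑-const c [] = refl
  ∑-const c (x ∷ xs) = trans (cong (λ s → c + s) (∑-const c xs)) (lemma c (+ length xs))
    where
    lemma : ∀ c n → c + n * c ≡ (+ 1 + n) * c
    lemma = solve-∀

  ∑-+ : (f g : A → ℤ) (xs : List A) → ∑ (λ x → f x + g x) xs ≡ ∑ f xs + ∑ g xs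
  ∑-+ f g [] = refl
  ∑-+ f g (x ∷ xs) = trans (cong (λ s → f x + g x + s) (∑-+ f g xs)) (lemma (f x) (g x) _ _)
    where
    lemma : ∀ a b c d → a + b + (c + d) ≡ a + c + (b + d)
    lemma = solve-∀

  ∑-neg : (f : A → ℤ) (xs : List A) → ∑ (λ x → - f x) xs ≡ - ∑ f xs
  ∑-neg f [] = refl
  ∑-neg f (x ∷ xs) = trans (cong (λ s → - f x + s) (∑-neg f xs)) (sym (ℤ.neg-distrib-+ (f x) _))

  ∑-++ : (f : A → ℤ) (xs ys : List A) → ∑ f (xs ++ ys) ≡ ∑ f xs + ∑ f ys
  ∑-++ f [] ys = sym (ℤ.+-identityˡ _)
  ∑-++ f (x ∷ xs) ys = trans (cong (λ s → f x + s) (∑-++ f xs ys)) (sym (ℤ.+-assoc (f x) _ _))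

  ∑-concatMap : (f : B → ℤ) (g : A → List B) (xs : List A) →
                ∑ f (concatMap g xs) ≡ ∑ (λ x → ∑ f (g x)) xs
  ∑-concatMap f g [] = refl
  ∑-concatMap f g (x ∷ xs) =
    trans (∑-++ f (g x) (concatMap g xs)) (cong (λ s → ∑ f (g x) + s) (∑-concatMap f g xs))

  ∑-swap : (f : A → B → ℤ) (xs : List A) (ys : List B) →
           ∑ (λ x → ∑ (f x) ys) xs ≡ ∑ (λ y → ∑ (λ x → f x y) xs) ys
  ∑-swap f [] ys = sym (trans (∑-const (+ 0) ys) (ℤ.*-zeroʳ (+ length ys)))
  ∑-swap f (x ∷ xs) ys =
    trans (cong (λ s → ∑ (f x) ys + s) (∑-swap f xs ys)) (sym (∑-+ (f x) (λ y → ∑ (λ x → f x y) xs) ys))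

  same-members⇒↭ : {xs ys : List A} → Unique xs → Unique ys →
                   (∀ {z} → z ∈ xs → z ∈ ys) → (∀ {z} → z ∈ ys → z ∈ xs) → xs ↭ ys
  same-members⇒↭ xs-unique ys-unique ⊆ ⊇ = ∼bag⇒↭ (unique∧set⇒bag xs-unique ys-unique (mk⇔ ⊆ ⊇))

  module _ {xs : List A} (xs-unique : Unique xs) (σ τ : A → A)
           (τ∘σ : ∀ x → τ (σ x) ≡ x) (σ∘τ : ∀ x → σ (τ x) ≡ x)
           (σ-∈ : ∀ {x} → x ∈ xs → σ x ∈ xs) (τ-∈ : ∀ {x} → x ∈ xs → τ x ∈ xs) where

    map-bijection-↭ : map σ xs ↭ xs
    map-bijection-↭ = same-members⇒↭ σxs-unique xs-unique to from
      where
      σxs-unique : Unique (map σ xs)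
      σxs-unique = Unique.map⁺ (λ {x} {y} σx≡σy → trans (sym (τ∘σ x)) (trans (cong τ σx≡σy) (τ∘σ y))) xs-unique
      to : ∀ {z} → z ∈ map σ xs → z ∈ xs
      to z∈ with ∈-map⁻ σ z∈
      ... | x , x∈ , refl = σ-∈ x∈
      from : ∀ {z} → z ∈ xs → z ∈ map σ xs
      from {z} z∈ = subst (_∈ map σ xs) (σ∘τ z) (∈-map⁺ σ (τ-∈ z∈))

    ∑-reindex : (f : A → ℤ) → ∑ (f ∘ σ) xs ≡ ∑ f xs
    ∑-reindex f = trans (sym (∑-map f σ xs)) (∑-↭ f map-bijection-↭)

  ∑-agree-except : DecidableEquality A → (f g : A → ℤ) {c : A} {xs : List A} → Unique xs → c ∈ xs →
             (∀ {x} → x ∈ xs → ¬ x ≡ c → f x ≡ g x) → ∑ f xs ≡ ∑ g xs + (f c - g c)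
  ∑-agree-except _≟_ f g {c} {x ∷ xs} (x∉xs ∷ xs-unique) c∈ f≡g with x ≟ c | c∈
  ... | yes refl | _ = trans (cong (λ s → f x + s) (∑-cong xs (λ y∈ → f≡g (there y∈) (c∉ y∈))))
                             (lemma (f x) (g x) (∑ g xs))
    where
    c∉ : ∀ {y} → y ∈ xs → ¬ y ≡ x
    c∉ y∈ refl = All.lookup x∉xs y∈ refl
    lemma : ∀ p q s → p + s ≡ (q + s) + (p - q)
    lemma = solve-∀
  ... | no x≢c | here c≡x = contradiction (sym c≡x) x≢c
  ... | no x≢c | there c∈xs =
    trans (cong₂ _+_ (f≡g (here refl) x≢c) (∑-agree-except _≟_ f g xs-unique c∈xs (λ y∈ → f≡g (there y∈))))
          (sym (ℤ.+-assoc (g x) _ _))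

module FiniteFieldTheory {r : ℕ} (F : FiniteField r) where

  open FiniteField F
  open ≡-Reasoning

  commutativeRing : CommutativeRing _ _
  commutativeRing = record { isCommutativeRing = isCommutativeRing }

  open CommutativeRing commutativeRing
    using ( +-identityˡ; +-identityʳ; *-identityˡ; *-identityʳ; zeroˡ; zeroʳ
          ; +-comm; *-comm; +-assoc; *-assoc; -‿inverseˡ; commutativeSemiring
          ; *-isCommutativeMonoid; ring; +-group )
  open import Algebra.Properties.Group +-group using () renaming (∙-cancelʳ to +-cancelʳ)
  open import Algebra.Properties.Ring ring using (-1*x≈-x; -‿involutive)
  open import Algebra.Solver.Ring.NaturalCoefficients.Default commutativeSemiring

  x*y≡0⇒y≡0 : ∀ {x y} → x ≢ 0# → x * y ≡ 0# → y ≡ 0#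
  x*y≡0⇒y≡0 {x} {y} x≢0 xy≡0 = begin
    y                    ≡⟨ sym (*-identityˡ y) ⟩
    1# * y               ≡⟨ cong (_* y) (sym (trans (*-comm _ x) (proj₂ (inverse x x≢0)))) ⟩
    (inv x x≢0 * x) * y  ≡⟨ *-assoc _ x y ⟩
    inv x x≢0 * (x * y)  ≡⟨ cong (inv x x≢0 *_) xy≡0 ⟩
    inv x x≢0 * 0#       ≡⟨ zeroʳ _ ⟩
    0#                   ∎

  *-≢0 : ∀ {x y} → x ≢ 0# → y ≢ 0# → x * y ≢ 0#
  *-≢0 x≢0 y≢0 xy≡0 = y≢0 (x*y≡0⇒y≡0 x≢0 xy≡0)

  -- Totalised inverse with 0 ⁻¹ = 0, so the identities below need no side conditions
  -- except where stated.
  infix 8 _⁻¹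
  _⁻¹ : Carrier → Carrier
  x ⁻¹ with x ≟ 0#
  ... | yes _   = 0#
  ... | no x≢0 = inv x x≢0

  0⁻¹ : 0# ⁻¹ ≡ 0#
  0⁻¹ with 0# ≟ 0#
  ... | yes _   = refl
  ... | no 0≢0 = contradiction refl 0≢0

  ⁻¹-unique : ∀ {x y} → x * y ≡ 1# → y ≡ x ⁻¹
  ⁻¹-unique {x} {y} xy≡1 with x ≟ 0#
  ... | yes refl = contradiction (trans (sym (zeroˡ y)) xy≡1) 0≢1
  ... | no x≢0  = begin
    y                    ≡⟨ sym (*-identityˡ y) ⟩
    1# * y               ≡⟨ cong (_* y) (sym (proj₂ (inverse x x≢0))) ⟩
    (x * inv x x≢0) * y  ≡⟨ solve 3 (λ x x' y → (x :* x') :* y := x' :* (x :* y)) refl x _ y ⟩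
    inv x x≢0 * (x * y)  ≡⟨ cong (inv x x≢0 *_) xy≡1 ⟩
    inv x x≢0 * 1#       ≡⟨ *-identityʳ _ ⟩
    inv x x≢0            ∎

  inv≡⁻¹ : ∀ {x} (x≢0 : x ≢ 0#) → inv x x≢0 ≡ x ⁻¹
  inv≡⁻¹ {x} x≢0 = ⁻¹-unique (proj₂ (inverse x x≢0))

  ⁻¹-inverseʳ : ∀ {x} → x ≢ 0# → x * x ⁻¹ ≡ 1#
  ⁻¹-inverseʳ {x} x≢0 = trans (cong (x *_) (sym (inv≡⁻¹ x≢0))) (proj₂ (inverse x x≢0))

  ⁻¹-≢0 : ∀ {x} → x ≢ 0# → x ⁻¹ ≢ 0#
  ⁻¹-≢0 {x} x≢0 x⁻¹≡0 = 0≢1 (begin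
    0#          ≡⟨ sym (zeroʳ x) ⟩
    x * 0#      ≡⟨ cong (x *_) (sym x⁻¹≡0) ⟩
    x * x ⁻¹    ≡⟨ ⁻¹-inverseʳ x≢0 ⟩
    1#          ∎)

  ⁻¹-involutive : ∀ x → x ⁻¹ ⁻¹ ≡ x
  ⁻¹-involutive x with x ≟ 0#
  ... | yes refl = 0⁻¹
  ... | no x≢0  = sym (⁻¹-unique (trans (*-comm _ x) (proj₂ (inverse x x≢0))))

  ⁻¹-distrib-* : ∀ x y → (x * y) ⁻¹ ≡ x ⁻¹ * y ⁻¹
  ⁻¹-distrib-* x y with x ≟ 0# | y ≟ 0#
  ... | yes refl | _        = trans (cong _⁻¹ (zeroˡ y)) (trans 0⁻¹ (sym (zeroˡ _)))
  ... | no _     | yes refl = trans (cong _⁻¹ (zeroʳ x)) (trans 0⁻¹ (sym (zeroʳ _)))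
  ... | no x≢0   | no y≢0   = sym (⁻¹-unique (begin
    (x * y) * (inv x x≢0 * inv y y≢0)  ≡⟨ solve 4 (λ x y x' y' → (x :* y) :* (x' :* y') := (x :* x') :* (y :* y')) refl x y _ _ ⟩
    (x * inv x x≢0) * (y * inv y y≢0)  ≡⟨ cong₂ _*_ (proj₂ (inverse x x≢0)) (proj₂ (inverse y y≢0)) ⟩
    1# * 1#                            ≡⟨ *-identityˡ 1# ⟩
    1#                                 ∎))

  Nonzero : Set
  Nonzero = Σ Carrier (λ x → x ≢ 0#)

  units : List Carrier
  units = map proj₁ nonzeros

  private
    -- Defs builds `nonzeros` with a local function that cannot be referred to by name;
    -- unification solves this meta to that function.
    mutual
      nonzerosOf : List Carrier → List Nonzero
      nonzerosOf = _

      nonzeros≡nonzerosOf : nonzeros ≡ nonzerosOf elements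
      nonzeros≡nonzerosOf with elements
      ... | xs = refl

    nonzerosOf≡filter : ∀ xs → map proj₁ (nonzerosOf xs) ≡ filter (λ x → ¬? (x ≟ 0#)) xs
    nonzerosOf≡filter [] = refl
    nonzerosOf≡filter (x ∷ xs) with x ≟ 0#
    ... | yes _ = nonzerosOf≡filter xs
    ... | no _  = cong (x ∷_) (nonzerosOf≡filter xs)

  units≡filter : units ≡ filter (λ x → ¬? (x ≟ 0#)) elements
  units≡filter = trans (cong (map proj₁) nonzeros≡nonzerosOf) (nonzerosOf≡filter elements)

  ∈-units : ∀ {x} → x ≢ 0# → x ∈ units
  ∈-units {x} x≢0 = subst (x ∈_) (sym units≡filter) (∈-filter⁺ (λ x → ¬? (x ≟ 0#)) (complete x) x≢0)

  ∈-units⁻ : ∀ {x} → x ∈ units → x ≢ 0#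
  ∈-units⁻ {x} x∈ = proj₂ (∈-filter⁻ (λ x → ¬? (x ≟ 0#)) {xs = elements} (subst (x ∈_) units≡filter x∈))

  units-unique : Unique units
  units-unique = subst Unique (sym units≡filter) (Unique.filter⁺ (λ x → ¬? (x ≟ 0#)) {elements} unique)

  elements↭0∷units : elements ↭ 0# ∷ units
  elements↭0∷units = same-members⇒↭ unique 0∷units-unique (λ {z} _ → to z) (λ {z} _ → complete z)
    where
    0∷units-unique : Unique (0# ∷ units)
    0∷units-unique = All.tabulate (λ z∈ 0≡z → ∈-units⁻ z∈ (sym 0≡z)) ∷ units-unique
    to : ∀ z → z ∈ 0# ∷ units
    to z with z ≟ 0#
    ... | yes z≡0 = here z≡0
    ... | no z≢0  = there (∈-units z≢0)

  N : ℕ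
  N = length units

  ∑* : (Carrier → ℤ) → ℤ
  ∑* f = ∑ f units

  q≡1+N : 2 ℕ.^ r ≡ suc N
  q≡1+N = trans (sym card) (↭.↭-length elements↭0∷units)

  x⁻¹*[x*y]≡y : ∀ {x} y → x ≢ 0# → x ⁻¹ * (x * y) ≡ y
  x⁻¹*[x*y]≡y {x} y x≢0 = begin
    x ⁻¹ * (x * y)   ≡⟨ solve 3 (λ x' x y → x' :* (x :* y) := (x :* x') :* y) refl _ x y ⟩
    (x * x ⁻¹) * y   ≡⟨ cong (_* y) (⁻¹-inverseʳ x≢0) ⟩
    1# * y           ≡⟨ *-identityˡ y ⟩
    y                ∎

  x*[x⁻¹*y]≡y : ∀ {x} y → x ≢ 0# → x * (x ⁻¹ * y) ≡ y
  x*[x⁻¹*y]≡y {x} y x≢0 = begin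
    x * (x ⁻¹ * y)   ≡⟨ sym (*-assoc x _ y) ⟩
    (x * x ⁻¹) * y   ≡⟨ cong (_* y) (⁻¹-inverseʳ x≢0) ⟩
    1# * y           ≡⟨ *-identityˡ y ⟩
    y                ∎

  module _ (σ τ : Carrier → Carrier) (τ∘σ : ∀ x → τ (σ x) ≡ x) (σ∘τ : ∀ x → σ (τ x) ≡ x)
           (σ0≡0 : σ 0# ≡ 0#) where

    private
      σ-∈ : ∀ {x} → x ∈ units → σ x ∈ units
      σ-∈ {x} x∈ = ∈-units (λ σx≡0 → ∈-units⁻ x∈ (begin
        x          ≡⟨ sym (τ∘σ x) ⟩
        τ (σ x)    ≡⟨ cong τ (trans σx≡0 (sym σ0≡0)) ⟩
        τ (σ 0#)   ≡⟨ τ∘σ 0# ⟩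
        0#         ∎))
      τ-∈ : ∀ {x} → x ∈ units → τ x ∈ units
      τ-∈ {x} x∈ = ∈-units (λ τx≡0 → ∈-units⁻ x∈ (begin
        x          ≡⟨ sym (σ∘τ x) ⟩
        σ (τ x)    ≡⟨ cong σ τx≡0 ⟩
        σ 0#       ≡⟨ σ0≡0 ⟩
        0#         ∎))

    units-bijection-↭ : map σ units ↭ units
    units-bijection-↭ = map-bijection-↭ units-unique σ τ τ∘σ σ∘τ σ-∈ τ-∈

    ∑*-reindex : (f : Carrier → ℤ) → ∑* (f ∘ σ) ≡ ∑* f
    ∑*-reindex = ∑-reindex units-unique σ τ τ∘σ σ∘τ σ-∈ τ-∈

  ∑-nonzeros : (h : Nonzero → ℤ) (g : Carrier → ℤ) → (∀ {x} (x≢0 : x ≢ 0#) → h (x , x≢0) ≡ g x) →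
               ∑ h nonzeros ≡ ∑* g
  ∑-nonzeros h g h≡g = trans (∑-cong nonzeros (λ {(x , x≢0)} _ → h≡g x≢0)) (sym (∑-map g proj₁ nonzeros))

  ∑-pairs : (G : Nonzero × Nonzero → ℤ) (g : Carrier → Carrier → ℤ) →
            (∀ {x y} (x≢0 : x ≢ 0#) (y≢0 : y ≢ 0#) → G ((x , x≢0) , (y , y≢0)) ≡ g x y) →
            ∑ G pairs ≡ ∑* (λ x → ∑* (g x))
  ∑-pairs G g G≡g = trans (∑-concatMap G (λ u → map (u ,_) nonzeros) nonzeros)
    (∑-nonzeros _ _ (λ x≢0 → trans (∑-map G (_ ,_) nonzeros) (∑-nonzeros _ _ (λ y≢0 → G≡g x≢0 y≢0))))

  length-pairs : ℤ.+ length pairs ≡ ℤ.+ N ℤ.* ℤ.+ N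
  length-pairs = begin
    ℤ.+ length pairs                 ≡⟨ sym (ℤ.*-identityʳ _) ⟩
    ℤ.+ length pairs ℤ.* 1ℤ          ≡⟨ sym (∑-const 1ℤ pairs) ⟩
    ∑ (λ _ → 1ℤ) pairs               ≡⟨ ∑-pairs _ (λ _ _ → 1ℤ) (λ _ _ → refl) ⟩
    ∑* (λ _ → ∑* (λ _ → 1ℤ))         ≡⟨ ∑-const _ units ⟩
    ℤ.+ N ℤ.* ∑* (λ _ → 1ℤ)          ≡⟨ cong (ℤ.+ N ℤ.*_) (trans (∑-const 1ℤ units) (ℤ.*-identityʳ _)) ⟩
    ℤ.+ N ℤ.* ℤ.+ N                  ∎

  ∑*-scale : ∀ {u} → u ≢ 0# → (f : Carrier → ℤ) → ∑* (λ x → f (u * x)) ≡ ∑* f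
  ∑*-scale {u} u≢0 = ∑*-reindex (u *_) (u ⁻¹ *_) (λ y → x⁻¹*[x*y]≡y y u≢0) (λ y → x*[x⁻¹*y]≡y y u≢0) (zeroʳ u)

  ∑*-shear : (g : Carrier → Carrier → ℤ) → ∑* (λ x → ∑* (g x)) ≡ ∑* (λ s → ∑* (λ x → g x (x * s)))
  ∑*-shear g = trans (∑-cong units (λ x∈ → sym (∑*-scale (∈-units⁻ x∈) (g _)))) (∑-swap (λ x s → g x (x * s)) units units)

  -- Fermat's little theorem

  ∏ : List Carrier → Carrier
  ∏ = foldr _*_ 1#

  ∏-↭ : ∀ {xs ys} → xs ↭ ys → ∏ xs ≡ ∏ ys
  ∏-↭ p = ↭ₛ.foldr-commMonoid (setoid Carrier) *-isCommutativeMonoid (↭⇒↭ₛ p)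

  ∏-map-* : ∀ u xs → ∏ (map (u *_) xs) ≡ pow u (length xs) * ∏ xs
  ∏-map-* u [] = sym (*-identityˡ 1#)
  ∏-map-* u (x ∷ xs) = trans (cong ((u * x) *_) (∏-map-* u xs))
    (solve 4 (λ u x p q → (u :* x) :* (p :* q) := (u :* p) :* (x :* q)) refl u x _ _)

  ∏-≢0 : ∀ xs → (∀ {x} → x ∈ xs → x ≢ 0#) → ∏ xs ≢ 0#
  ∏-≢0 [] _ 1≡0 = 0≢1 (sym 1≡0)
  ∏-≢0 (x ∷ xs) xs≢0 = *-≢0 (xs≢0 (here refl)) (∏-≢0 xs (xs≢0 ∘ there))

  -- Multiplication by x permutes the units, so x ^ N fixes their (nonzero) product.
  pow-N≡1 : ∀ {x} → x ≢ 0# → pow x N ≡ 1#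
  pow-N≡1 {x} x≢0 = begin
    pow x N                ≡⟨ sym (*-identityʳ _) ⟩
    pow x N * 1#           ≡⟨ cong (pow x N *_) (sym (⁻¹-inverseʳ P≢0)) ⟩
    pow x N * (P * P ⁻¹)   ≡⟨ sym (*-assoc _ P _) ⟩
    (pow x N * P) * P ⁻¹   ≡⟨ cong (_* P ⁻¹) (trans (sym (∏-map-* x units)) (∏-↭ scale-↭)) ⟩
    P * P ⁻¹               ≡⟨ ⁻¹-inverseʳ P≢0 ⟩
    1#                     ∎
    where
    P : Carrier
    P = ∏ units
    P≢0 : P ≢ 0#
    P≢0 = ∏-≢0 units ∈-units⁻
    scale-↭ : map (x *_) units ↭ units
    scale-↭ = units-bijection-↭ (x *_) (x ⁻¹ *_) (λ y → x⁻¹*[x*y]≡y y x≢0) (λ y → x*[x⁻¹*y]≡y y x≢0) (zeroʳ x)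

  fermat : ∀ x → pow x (2 ℕ.^ r) ≡ x
  fermat x rewrite q≡1+N with x ≟ 0#
  ... | yes refl = zeroˡ _
  ... | no x≢0  = trans (cong (x *_) (pow-N≡1 x≢0)) (*-identityʳ x)

  -- Characteristic two and square roots

  pow-+ : ∀ x m n → pow x (m ℕ.+ n) ≡ pow x m * pow x n
  pow-+ x zero n = sym (*-identityˡ _)
  pow-+ x (suc m) n = trans (cong (x *_) (pow-+ x m n)) (sym (*-assoc x _ _))

  pow-distrib-* : ∀ x y n → pow (x * y) n ≡ pow x n * pow y n
  pow-distrib-* x y zero = sym (*-identityˡ 1#)
  pow-distrib-* x y (suc n) = trans (cong ((x * y) *_) (pow-distrib-* x y n))
    (solve 4 (λ x y p q → (x :* y) :* (p :* q) := (x :* p) :* (y :* q)) refl x y _ _)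

  pow-2^suc : ∀ x j → pow x (2 ℕ.^ suc j) ≡ pow x (2 ℕ.^ j) * pow x (2 ℕ.^ j)
  pow-2^suc x j = trans (cong (λ n → pow x (2 ℕ.^ j ℕ.+ n)) (ℕ.+-identityʳ (2 ℕ.^ j))) (pow-+ x (2 ℕ.^ j) _)

  r≡suc[pred-r] : r ≡ suc (ℕ.pred r)
  r≡suc[pred-r] = lemma r q≡1+N
    where
    N≢0 : N ≢ 0
    N≢0 with units | ∈-units {1#} (0≢1 ∘ sym)
    ... | _ ∷ _ | _ = λ ()
    lemma : ∀ s → 2 ℕ.^ s ≡ suc N → s ≡ suc (ℕ.pred s)
    lemma zero    1≡1+N = contradiction (sym (ℕ.suc-injective 1≡1+N)) N≢0
    lemma (suc s) _     = refl

  pow-[-1]-2^suc : ∀ j → pow (- 1#) (2 ℕ.^ suc j) ≡ 1#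
  pow-[-1]-2^suc zero = trans (cong ((- 1#) *_) (*-identityʳ _)) (trans (-1*x≈-x (- 1#)) (-‿involutive 1#))
  pow-[-1]-2^suc (suc j) = trans (pow-2^suc (- 1#) (suc j))
    (trans (cong₂ _*_ (pow-[-1]-2^suc j) (pow-[-1]-2^suc j)) (*-identityˡ 1#))

  -- Fermat for -1 shows -1 = (-1) ^ q = 1, since q is even.
  1+1≡0 : 1# + 1# ≡ 0#
  1+1≡0 = begin
    1# + 1#                              ≡⟨ cong (_+ 1#) (sym (pow-[-1]-2^suc (ℕ.pred r))) ⟩
    pow (- 1#) (2 ℕ.^ suc (ℕ.pred r)) + 1# ≡⟨ cong (λ n → pow (- 1#) (2 ℕ.^ n) + 1#) (sym r≡suc[pred-r]) ⟩
    pow (- 1#) (2 ℕ.^ r) + 1#            ≡⟨ cong (_+ 1#) (fermat (- 1#)) ⟩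
    - 1# + 1#                            ≡⟨ -‿inverseˡ 1# ⟩
    0#                                   ∎

  x+x≡0 : ∀ x → x + x ≡ 0#
  x+x≡0 x = begin
    x + x             ≡⟨ solve 1 (λ x → x :+ x := x :* (con 1 :+ con 1)) refl x ⟩
    x * (1# + 1#)     ≡⟨ cong (x *_) 1+1≡0 ⟩
    x * 0#            ≡⟨ zeroʳ x ⟩
    0#                ∎

  x+y≡0⇒x≡y : ∀ {x y} → x + y ≡ 0# → x ≡ y
  x+y≡0⇒x≡y {x} {y} x+y≡0 = begin
    x                 ≡⟨ sym (+-identityʳ x) ⟩
    x + 0#            ≡⟨ cong (λ z → x + z) (sym (x+x≡0 y)) ⟩
    x + (y + y)       ≡⟨ sym (+-assoc x y y) ⟩
    (x + y) + y       ≡⟨ cong (_+ y) x+y≡0 ⟩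
    0# + y            ≡⟨ +-identityˡ y ⟩
    y                 ∎

  square-+ : ∀ x y → (x + y) * (x + y) ≡ x * x + y * y
  square-+ x y = begin
    (x + y) * (x + y)                  ≡⟨ solve 2 (λ x y → (x :+ y) :* (x :+ y) := x :* x :+ y :* y :+ x :* y :* (con 1 :+ con 1)) refl x y ⟩
    x * x + y * y + x * y * (1# + 1#)  ≡⟨ cong (λ z → x * x + y * y + x * y * z) 1+1≡0 ⟩
    x * x + y * y + x * y * 0#         ≡⟨ cong (λ z → x * x + y * y + z) (zeroʳ _) ⟩
    x * x + y * y + 0#                 ≡⟨ +-identityʳ _ ⟩
    x * x + y * y                      ∎

  pow-2^-+ : ∀ x y j → pow (x + y) (2 ℕ.^ j) ≡ pow x (2 ℕ.^ j) + pow y (2 ℕ.^ j)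
  pow-2^-+ x y zero = solve 2 (λ x y → (x :+ y) :* con 1 := x :* con 1 :+ y :* con 1) refl x y
  pow-2^-+ x y (suc j) = begin
    pow (x + y) (2 ℕ.^ suc j)   ≡⟨ pow-2^suc (x + y) j ⟩
    X+Y * X+Y                   ≡⟨ cong₂ _*_ (pow-2^-+ x y j) (pow-2^-+ x y j) ⟩
    (X + Y) * (X + Y)           ≡⟨ square-+ X Y ⟩
    X * X + Y * Y               ≡⟨ sym (cong₂ _+_ (pow-2^suc x j) (pow-2^suc y j)) ⟩
    pow x (2 ℕ.^ suc j) + pow y (2 ℕ.^ suc j) ∎
    where
    X+Y X Y : Carrier
    X+Y = pow (x + y) (2 ℕ.^ j)
    X = pow x (2 ℕ.^ j)
    Y = pow y (2 ℕ.^ j)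

  √ : Carrier → Carrier
  √ x = pow x (2 ℕ.^ ℕ.pred r)

  √x*√x≡x : ∀ x → √ x * √ x ≡ x
  √x*√x≡x x = begin
    √ x * √ x                        ≡⟨ sym (pow-2^suc x (ℕ.pred r)) ⟩
    pow x (2 ℕ.^ suc (ℕ.pred r))     ≡⟨ cong (λ n → pow x (2 ℕ.^ n)) (sym r≡suc[pred-r]) ⟩
    pow x (2 ℕ.^ r)                  ≡⟨ fermat x ⟩
    x                                ∎

  √[x*x]≡x : ∀ x → √ (x * x) ≡ x
  √[x*x]≡x x = trans (pow-distrib-* x x (2 ℕ.^ ℕ.pred r)) (√x*√x≡x x)

  ∑*-square : (f : Carrier → ℤ) → ∑* (λ x → f (x * x)) ≡ ∑* f
  ∑*-square = ∑*-reindex (λ x → x * x) √ √[x*x]≡x √x*√x≡x (zeroˡ 0#)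

  -- The absolute trace

  trAux-+ : ∀ n x y → trAux n (x + y) ≡ trAux n x + trAux n y
  trAux-+ zero x y = sym (+-identityˡ 0#)
  trAux-+ (suc n) x y = trans (cong₂ _+_ (pow-2^-+ x y n) (trAux-+ n x y))
    (solve 4 (λ a b c d → (a :+ b) :+ (c :+ d) := (a :+ c) :+ (b :+ d)) refl _ _ _ _)

  tr-+ : ∀ x y → tr (x + y) ≡ tr x + tr y
  tr-+ = trAux-+ r

  tr-0 : tr 0# ≡ 0#
  tr-0 = trans (cong tr (sym (+-identityˡ 0#))) (trans (tr-+ 0# 0#) (x+x≡0 (tr 0#)))

  -- The sum defining trAux n (x * x) is that of trAux n x shifted by one term.
  trAux-square : ∀ n x → trAux n (x * x) + x ≡ pow x (2 ℕ.^ n) + trAux n x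
  trAux-square zero x = trans (+-identityˡ x) (sym (trans (+-identityʳ _) (*-identityʳ x)))
  trAux-square (suc n) x = begin
    (pow (x * x) (2 ℕ.^ n) + trAux n (x * x)) + x    ≡⟨ +-assoc _ _ x ⟩
    pow (x * x) (2 ℕ.^ n) + (trAux n (x * x) + x)    ≡⟨ cong₂ _+_ (trans (pow-distrib-* x x (2 ℕ.^ n)) (sym (pow-2^suc x n))) (trAux-square n x) ⟩
    pow x (2 ℕ.^ suc n) + (pow x (2 ℕ.^ n) + trAux n x) ∎

  tr-square : ∀ x → tr (x * x) ≡ tr x
  tr-square x = +-cancelʳ x _ _ (trans (trAux-square r x) (trans (cong (_+ tr x) (fermat x)) (+-comm x _)))

  trAux²≡trAux-square : ∀ n x → trAux n x * trAux n x ≡ trAux n (x * x)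
  trAux²≡trAux-square zero x = zeroˡ 0#
  trAux²≡trAux-square (suc n) x = trans (square-+ _ _)
    (cong₂ _+_ (sym (pow-distrib-* x x (2 ℕ.^ n))) (trAux²≡trAux-square n x))

  idempotent⇒0⊎1 : ∀ {e} → e * e ≡ e → e ≡ 0# ⊎ e ≡ 1#
  idempotent⇒0⊎1 {e} e²≡e with e ≟ 0#
  ... | yes e≡0 = inj₁ e≡0
  ... | no e≢0  = inj₂ (begin
    e                ≡⟨ sym (*-identityʳ e) ⟩
    e * 1#           ≡⟨ cong (e *_) (sym (⁻¹-inverseʳ e≢0)) ⟩
    e * (e * e ⁻¹)   ≡⟨ sym (*-assoc e e _) ⟩
    (e * e) * e ⁻¹   ≡⟨ cong (_* e ⁻¹) e²≡e ⟩
    e * e ⁻¹         ≡⟨ ⁻¹-inverseʳ e≢0 ⟩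
    1#               ∎)

  tr-0⊎1 : ∀ x → tr x ≡ 0# ⊎ tr x ≡ 1#
  tr-0⊎1 x = idempotent⇒0⊎1 (trans (trAux²≡trAux-square r x) (tr-square x))

  -- Roots of polynomials

  eval : ℕ → (ℕ → Carrier) → Carrier → Carrier
  eval zero    f x = 0#
  eval (suc n) f x = f 0 + x * eval n (f ∘ suc) x

  -- Coefficients of the quotient by X + c, which is X - c in characteristic 2.
  quotient : ℕ → Carrier → (ℕ → Carrier) → ℕ → Carrier
  quotient zero    c f j       = 0#
  quotient (suc n) c f zero    = eval (suc n) (f ∘ suc) c
  quotient (suc n) c f (suc j) = quotient n c (f ∘ suc) j

  eval-division : ∀ n c f x → eval (suc n) f x ≡ (x + c) * eval n (quotient n c f) x + eval (suc n) f c
  eval-division zero c f x =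
    solve 3 (λ a x c → a :+ x :* con 0 := (x :+ c) :* con 0 :+ (a :+ c :* con 0)) refl (f 0) x c
  eval-division (suc n) c f x = begin
    f 0 + x * eval (suc n) (f ∘ suc) x            ≡⟨ cong (λ z → f 0 + x * z) (eval-division n c (f ∘ suc) x) ⟩
    f 0 + x * ((x + c) * Q + R)                   ≡⟨ sym (+-identityʳ _) ⟩
    f 0 + x * ((x + c) * Q + R) + 0#              ≡⟨ cong (λ z → f 0 + x * ((x + c) * Q + R) + z) (sym (x+x≡0 (c * R))) ⟩
    f 0 + x * ((x + c) * Q + R) + (c * R + c * R) ≡⟨ solve 5 (λ a x c q r → a :+ x :* ((x :+ c) :* q :+ r) :+ (c :* r :+ c :* r)
                                                                  := (x :+ c) :* (r :+ x :* q) :+ (a :+ c :* r)) refl (f 0) x c Q R ⟩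
    (x + c) * (R + x * Q) + (f 0 + c * R)         ∎
    where
    Q R : Carrier
    Q = eval n (quotient n c (f ∘ suc)) x
    R = eval (suc n) (f ∘ suc) c

  quotient≡0⇒coefficients≡0 : ∀ n c f → (∀ j → j ℕ.< n → quotient n c f j ≡ 0#) → eval (suc n) f c ≡ 0# →
                               ∀ j → j ℕ.< suc n → f j ≡ 0#
  quotient≡0⇒coefficients≡0 zero c f _ fc≡0 zero _ = trans (sym (trans (cong (f 0 +_) (zeroʳ c)) (+-identityʳ _))) fc≡0
  quotient≡0⇒coefficients≡0 zero c f _ _ (suc j) (s≤s ())
  quotient≡0⇒coefficients≡0 (suc n) c f q≡0 fc≡0 zero _ =
    trans (sym (trans (cong (λ z → f 0 + c * z) (q≡0 0 (s≤s z≤n))) (trans (cong (f 0 +_) (zeroʳ c)) (+-identityʳ _)))) fc≡0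
  quotient≡0⇒coefficients≡0 (suc n) c f q≡0 _ (suc j) (s≤s j<1+n) =
    quotient≡0⇒coefficients≡0 n c (f ∘ suc) (λ j j<n → q≡0 (suc j) (s≤s j<n)) (q≡0 0 (s≤s z≤n)) j j<1+n

  eval-vanishes⇒coefficients≡0 : ∀ xs f → Unique xs → (∀ {y} → y ∈ xs → eval (length xs) f y ≡ 0#) →
                                 ∀ j → j ℕ.< length xs → f j ≡ 0#
  eval-vanishes⇒coefficients≡0 (c ∷ ys) f (c∉ys ∷ ys-unique) f≡0 =
    quotient≡0⇒coefficients≡0 n c f
      (eval-vanishes⇒coefficients≡0 ys (quotient n c f) ys-unique quotient≡0) (f≡0 (here refl))
    where
    n : ℕ
    n = length ys
    quotient≡0 : ∀ {y} → y ∈ ys → eval n (quotient n c f) y ≡ 0#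
    quotient≡0 {y} y∈ = x*y≡0⇒y≡0 (λ y+c≡0 → All.lookup c∉ys y∈ (sym (x+y≡0⇒x≡y y+c≡0))) (begin
      (y + c) * eval n (quotient n c f) y                        ≡⟨ sym (+-identityʳ _) ⟩
      (y + c) * eval n (quotient n c f) y + 0#                   ≡⟨ cong (λ z → (y + c) * eval n (quotient n c f) y + z) (sym (f≡0 (here refl))) ⟩
      (y + c) * eval n (quotient n c f) y + eval (suc n) f c     ≡⟨ sym (eval-division n c f y) ⟩
      eval (suc n) f y                                           ≡⟨ f≡0 (there y∈) ⟩
      0#                                                         ∎)

  monomial : ℕ → ℕ → Carrier
  monomial k j = if j ℕ.≡ᵇ k then 1# else 0#

  eval-0 : ∀ n x → eval n (λ _ → 0#) x ≡ 0#
  eval-0 zero x = refl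
  eval-0 (suc n) x = trans (cong (λ z → 0# + x * z) (eval-0 n x)) (trans (cong (0# +_) (zeroʳ x)) (+-identityˡ 0#))

  eval-monomial : ∀ n k x → k ℕ.< n → eval n (monomial k) x ≡ pow x k
  eval-monomial (suc n) zero x _ =
    trans (cong (λ z → 1# + x * z) (eval-0 n x)) (trans (cong (1# +_) (zeroʳ x)) (+-identityʳ 1#))
  eval-monomial (suc n) (suc k) x (s≤s k<n) = trans (cong (λ z → 0# + x * z) (eval-monomial n k x k<n)) (+-identityˡ _)

  eval-+ : ∀ n f g x → eval n (λ j → f j + g j) x ≡ eval n f x + eval n g x
  eval-+ zero f g x = sym (+-identityˡ 0#)
  eval-+ (suc n) f g x = trans (cong (λ z → f 0 + g 0 + x * z) (eval-+ n (f ∘ suc) (g ∘ suc) x))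
    (solve 5 (λ a b x c d → (a :+ b) :+ x :* (c :+ d) := (a :+ x :* c) :+ (b :+ x :* d)) refl (f 0) (g 0) x _ _)

  trCoefficient : ℕ → ℕ → Carrier
  trCoefficient zero    j = 0#
  trCoefficient (suc m) j = monomial (2 ℕ.^ m) j + trCoefficient m j

  eval-trCoefficient : ∀ m x → m ℕ.≤ r → eval (2 ℕ.^ r) (trCoefficient m) x ≡ trAux m x
  eval-trCoefficient zero x _ = eval-0 (2 ℕ.^ r) x
  eval-trCoefficient (suc m) x m<r = trans (eval-+ (2 ℕ.^ r) (monomial (2 ℕ.^ m)) (trCoefficient m) x)
    (cong₂ _+_ (eval-monomial (2 ℕ.^ r) (2 ℕ.^ m) x (ℕ.^-monoʳ-< 2 (s≤s (s≤s z≤n)) m<r))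
               (eval-trCoefficient m x (ℕ.<⇒≤ m<r)))

  trCoefficient-1 : ∀ m → trCoefficient (suc m) 1 ≡ 1#
  trCoefficient-1 zero = +-identityʳ 1#
  trCoefficient-1 (suc m) = trans (cong (_+ trCoefficient (suc m) 1) (monomial≡0 (ℕ.*-monoʳ-≤ 2 (ℕ.m^n>0 2 m))))
                                  (trans (+-identityˡ _) (trCoefficient-1 m))
    where
    monomial≡0 : ∀ {k} → 2 ℕ.≤ k → monomial k 1 ≡ 0#
    monomial≡0 {suc zero}    (s≤s ())
    monomial≡0 {suc (suc k)} _ = refl

  -- The trace is a polynomial of degree 2 ^ (r - 1) < q, so it cannot vanish on all of F.
  tr-nonzero : ∃ λ β → tr β ≢ 0#
  tr-nonzero with all? (λ x → tr x ≟ 0#) elements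
  ... | no ¬all = Any.satisfied (¬All⇒Any¬ (λ x → tr x ≟ 0#) elements ¬all)
  ... | yes all = contradiction (eval-vanishes⇒coefficients≡0 elements (trCoefficient r) unique vanishes 1 1<q) 1≢0
    where
    vanishes : ∀ {y} → y ∈ elements → eval (length elements) (trCoefficient r) y ≡ 0#
    vanishes {y} y∈ rewrite card = trans (eval-trCoefficient r y ℕ.≤-refl) (All.lookup all y∈)
    1<q : 1 ℕ.< length elements
    1<q = subst (1 ℕ.<_) (sym card)
            (subst (λ s → 1 ℕ.< 2 ℕ.^ s) (sym r≡suc[pred-r]) (ℕ.*-monoʳ-≤ 2 (ℕ.m^n>0 2 (ℕ.pred r))))
    1≢0 : trCoefficient r 1 ≢ 0#
    1≢0 1≡0 = 0≢1 (trans (sym 1≡0) (subst (λ s → trCoefficient s 1 ≡ 1#) (sym r≡suc[pred-r]) (trCoefficient-1 (ℕ.pred r))))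

  -- The character λ

  sign : Carrier → ℤ
  sign e with e ≟ 0#
  ... | yes _ = 1ℤ
  ... | no _  = -1ℤ

  sign-0 : sign 0# ≡ 1ℤ
  sign-0 with 0# ≟ 0#
  ... | yes _   = refl
  ... | no 0≢0 = contradiction refl 0≢0

  sign-1 : sign 1# ≡ -1ℤ
  sign-1 with 1# ≟ 0#
  ... | yes 1≡0 = contradiction (sym 1≡0) 0≢1
  ... | no _    = refl

  2*weight≡length-∑sign : ∀ v → ℤ.+ 2 ℤ.* ℤ.+ weight v ≡ ℤ.+ length v ℤ.- ∑ sign v
  2*weight≡length-∑sign [] = refl
  2*weight≡length-∑sign (e ∷ v) with e ≟ 0#
  ... | yes _ = trans (2*weight≡length-∑sign v) (lemma (ℤ.+ length v) (∑ sign v))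
    where
    lemma : ∀ n s → n ℤ.- s ≡ (1ℤ ℤ.+ n) ℤ.- (1ℤ ℤ.+ s)
    lemma = solve-∀
  ... | no _  = trans (lemma₁ (ℤ.+ weight v))
                  (trans (cong (λ z → ℤ.+ 2 ℤ.+ z) (2*weight≡length-∑sign v)) (lemma₂ (ℤ.+ length v) (∑ sign v)))
    where
    lemma₁ : ∀ w → ℤ.+ 2 ℤ.* (1ℤ ℤ.+ w) ≡ ℤ.+ 2 ℤ.+ ℤ.+ 2 ℤ.* w
    lemma₁ = solve-∀
    lemma₂ : ∀ n s → ℤ.+ 2 ℤ.+ (n ℤ.- s) ≡ (1ℤ ℤ.+ n) ℤ.- (-1ℤ ℤ.+ s)
    lemma₂ = solve-∀

  λχ≡sign∘tr : ∀ x → λχ x ≡ sign (tr x)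
  λχ≡sign∘tr x with tr x ≟ 0#
  ... | yes _ = refl
  ... | no _  = refl

  λχ-cong-tr : ∀ {x y} → tr x ≡ tr y → λχ x ≡ λχ y
  λχ-cong-tr {x} {y} trx≡try = trans (λχ≡sign∘tr x) (trans (cong sign trx≡try) (sym (λχ≡sign∘tr y)))

  λχ-square : ∀ x → λχ (x * x) ≡ λχ x
  λχ-square x = λχ-cong-tr (tr-square x)

  λχ-square-+ : ∀ x y → λχ (x * x + y) ≡ λχ (x + y)
  λχ-square-+ x y = λχ-cong-tr (trans (tr-+ (x * x) y) (trans (cong (_+ tr y) (tr-square x)) (sym (tr-+ x y))))

  λχ-0 : λχ 0# ≡ 1ℤ
  λχ-0 = trans (λχ≡sign∘tr 0#) (trans (cong sign tr-0) sign-0)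

  λχ-+-tr≡1 : ∀ {β} → tr β ≡ 1# → ∀ x → λχ (x + β) ≡ ℤ.- λχ x
  λχ-+-tr≡1 {β} trβ≡1 x = trans (λχ≡sign∘tr (x + β))
    (trans (cong sign (trans (tr-+ x β) (cong (tr x +_) trβ≡1))) (by-tr-value (tr-0⊎1 x)))
    where
    by-tr-value : tr x ≡ 0# ⊎ tr x ≡ 1# → sign (tr x + 1#) ≡ ℤ.- λχ x
    by-tr-value (inj₁ trx≡0) = begin
      sign (tr x + 1#)   ≡⟨ cong sign (trans (cong (_+ 1#) trx≡0) (+-identityˡ 1#)) ⟩
      sign 1#            ≡⟨ sign-1 ⟩
      ℤ.- 1ℤ             ≡⟨ cong ℤ.-_ (sym (trans (λχ≡sign∘tr x) (trans (cong sign trx≡0) sign-0))) ⟩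
      ℤ.- λχ x           ∎
    by-tr-value (inj₂ trx≡1) = begin
      sign (tr x + 1#)   ≡⟨ cong sign (trans (cong (_+ 1#) trx≡1) 1+1≡0) ⟩
      sign 0#            ≡⟨ sign-0 ⟩
      ℤ.- -1ℤ            ≡⟨ cong ℤ.-_ (sym (trans (λχ≡sign∘tr x) (trans (cong sign trx≡1) sign-1))) ⟩
      ℤ.- λχ x           ∎

  -- Translation by an element of trace 1 negates every term.
  ∑-λχ-elements : ∑ λχ elements ≡ ℤ.+ 0
  ∑-λχ-elements with tr-nonzero
  ... | β , trβ≢0 = x≡-x⇒x≡0 (begin
    ∑ λχ elements                ≡⟨ sym (∑-reindex unique (_+ β) (_+ β) +β+β (+β+β) (λ _ → complete _) (λ _ → complete _) λχ) ⟩
    ∑ (λ x → λχ (x + β)) elements ≡⟨ ∑-cong elements (λ {x} _ → λχ-+-tr≡1 trβ≡1 x) ⟩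
    ∑ (λ x → ℤ.- λχ x) elements  ≡⟨ ∑-neg λχ elements ⟩
    ℤ.- ∑ λχ elements            ∎)
    where
    trβ≡1 : tr β ≡ 1#
    trβ≡1 with tr-0⊎1 β
    ... | inj₁ trβ≡0 = contradiction trβ≡0 trβ≢0
    ... | inj₂ trβ≡1 = trβ≡1
    +β+β : ∀ x → x + β + β ≡ x
    +β+β x = trans (+-assoc x β β) (trans (cong (λ z → x + z) (x+x≡0 β)) (+-identityʳ x))
    x≡-x⇒x≡0 : ∀ {x} → x ≡ ℤ.- x → x ≡ ℤ.+ 0
    x≡-x⇒x≡0 {ℤ.+ zero}  _ = refl
    x≡-x⇒x≡0 {ℤ.+ suc _} ()
    x≡-x⇒x≡0 {ℤ.-[1+ _ ]} ()

  ∑*-λχ : ∑* λχ ≡ -1ℤ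
  ∑*-λχ = begin
    ∑* λχ                       ≡⟨ lemma (∑* λχ) ⟩
    (1ℤ ℤ.+ ∑* λχ) ℤ.+ -1ℤ      ≡⟨ cong (λ s → (s ℤ.+ ∑* λχ) ℤ.+ -1ℤ) (sym λχ-0) ⟩
    (λχ 0# ℤ.+ ∑* λχ) ℤ.+ -1ℤ   ≡⟨ cong (ℤ._+ -1ℤ) (trans (sym (∑-↭ λχ elements↭0∷units)) ∑-λχ-elements) ⟩
    ℤ.+ 0 ℤ.+ -1ℤ               ≡⟨ ℤ.+-identityˡ -1ℤ ⟩
    -1ℤ                         ∎
    where
    lemma : ∀ s → s ≡ (1ℤ ℤ.+ s) ℤ.+ -1ℤ
    lemma = solve-∀

  -- Kloosterman sums

  K₁ : Carrier → ℤ
  K₁ β = ∑* (λ w → λχ (w + β * w ⁻¹))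

  K₁-0 : K₁ 0# ≡ -1ℤ
  K₁-0 = trans (∑-cong units (λ {w} _ → cong λχ (trans (cong (w +_) (zeroˡ _)) (+-identityʳ w)))) ∑*-λχ

  K₁-square : ∀ β → K₁ (β * β) ≡ K₁ β
  K₁-square β = begin
    ∑* (λ w → λχ (w + β * β * w ⁻¹))                     ≡⟨ sym (∑*-square (λ w → λχ (w + β * β * w ⁻¹))) ⟩
    ∑* (λ t → λχ (t * t + β * β * (t * t) ⁻¹))           ≡⟨ ∑-cong units (λ {t} _ → cong λχ (as-square t)) ⟩
    ∑* (λ t → λχ ((t + β * t ⁻¹) * (t + β * t ⁻¹)))      ≡⟨ ∑-cong units (λ {t} _ → λχ-square _) ⟩
    ∑* (λ t → λχ (t + β * t ⁻¹))                         ∎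
    where
    as-square : ∀ t → t * t + β * β * (t * t) ⁻¹ ≡ (t + β * t ⁻¹) * (t + β * t ⁻¹)
    as-square t = begin
      t * t + β * β * (t * t) ⁻¹               ≡⟨ cong (λ z → t * t + β * β * z) (⁻¹-distrib-* t t) ⟩
      t * t + β * β * (t ⁻¹ * t ⁻¹)            ≡⟨ cong (t * t +_) (solve 2 (λ b u → b :* b :* (u :* u) := (b :* u) :* (b :* u)) refl β _) ⟩
      t * t + (β * t ⁻¹) * (β * t ⁻¹)          ≡⟨ sym (square-+ t _) ⟩
      (t + β * t ⁻¹) * (t + β * t ⁻¹)          ∎

  ∑*-λχ-linear+inverse : ∀ u {v} → v ≢ 0# → ∑* (λ x → λχ (u * x + v * x ⁻¹)) ≡ K₁ (u * v)
  ∑*-λχ-linear+inverse u {v} v≢0 = begin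
    ∑* (λ x → λχ (u * x + v * x ⁻¹))                       ≡⟨ sym (∑*-reindex σ σ σ∘σ σ∘σ σ0≡0 (λ x → λχ (u * x + v * x ⁻¹))) ⟩
    ∑* (λ x → λχ (u * (v * x ⁻¹) + v * (v * x ⁻¹) ⁻¹))     ≡⟨ ∑-cong units (λ {x} _ → cong λχ (swap x)) ⟩
    ∑* (λ x → λχ (x + u * v * x ⁻¹))                       ∎
    where
    σ : Carrier → Carrier
    σ x = v * x ⁻¹
    σ∘σ : ∀ x → σ (σ x) ≡ x
    σ∘σ x = begin
      v * (v * x ⁻¹) ⁻¹        ≡⟨ cong (v *_) (trans (⁻¹-distrib-* v _) (cong (v ⁻¹ *_) (⁻¹-involutive x))) ⟩
      v * (v ⁻¹ * x)           ≡⟨ x*[x⁻¹*y]≡y x v≢0 ⟩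
      x                        ∎
    σ0≡0 : σ 0# ≡ 0#
    σ0≡0 = trans (cong (v *_) 0⁻¹) (zeroʳ v)
    swap : ∀ x → u * (v * x ⁻¹) + v * (v * x ⁻¹) ⁻¹ ≡ x + u * v * x ⁻¹
    swap x = trans (cong (u * (v * x ⁻¹) +_) (σ∘σ x))
      (solve 4 (λ u v y x → u :* (v :* y) :+ x := x :+ u :* v :* y) refl u v (x ⁻¹) x)

  ∑*-λχ-linear+inverse² : ∀ u {v} → v ≢ 0# → ∑* (λ x → λχ (u * x + v * (x * x) ⁻¹)) ≡ K₁ (u * u * v)
  ∑*-λχ-linear+inverse² u {v} v≢0 = begin
    ∑* (λ x → λχ (u * x + v * (x * x) ⁻¹))                 ≡⟨ ∑-cong units (λ {x} _ → sym (λχ-square-+ (u * x) _)) ⟩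
    ∑* (λ x → λχ ((u * x) * (u * x) + v * (x * x) ⁻¹))     ≡⟨ ∑-cong units (λ {x} _ → cong (λ z → λχ (z + v * (x * x) ⁻¹))
                                                                (solve 2 (λ u x → (u :* x) :* (u :* x) := u :* u :* (x :* x)) refl u x)) ⟩
    ∑* (λ x → λχ (u * u * (x * x) + v * (x * x) ⁻¹))       ≡⟨ ∑*-square (λ z → λχ (u * u * z + v * z ⁻¹)) ⟩
    ∑* (λ z → λχ (u * u * z + v * z ⁻¹))                   ≡⟨ ∑*-λχ-linear+inverse (u * u) v≢0 ⟩
    K₁ (u * u * v)                                          ∎

  κ : Carrier → Carrier
  κ s = (1# + s) * (1# + s) * s ⁻¹

  κ-1 : κ 1# ≡ 0#
  κ-1 = trans (cong (λ z → z * z * 1# ⁻¹) 1+1≡0) (trans (cong (_* 1# ⁻¹) (zeroˡ 0#)) (zeroˡ _))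

  κ-square : ∀ s → κ (s * s) ≡ κ s * κ s
  κ-square s = begin
    (1# + s * s) * (1# + s * s) * (s * s) ⁻¹            ≡⟨ cong₂ (λ y z → y * y * z) 1+s²≡[1+s]² (⁻¹-distrib-* s s) ⟩
    ((1# + s) * (1# + s)) * ((1# + s) * (1# + s)) * (s ⁻¹ * s ⁻¹)
      ≡⟨ solve 2 (λ u v → (u :* u) :* (u :* u) :* (v :* v) := (u :* u :* v) :* (u :* u :* v)) refl (1# + s) (s ⁻¹) ⟩
    κ s * κ s                                           ∎
    where
    1+s²≡[1+s]² : 1# + s * s ≡ (1# + s) * (1# + s)
    1+s²≡[1+s]² = sym (trans (square-+ 1# s) (cong (_+ s * s) (*-identityˡ 1#)))

  module _ {a : Carrier} (a≢0 : a ≢ 0#) where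

    ∑-sign-d≡∑*∑* : ∑ sign (d a) ≡ ∑* (λ s → ∑* (λ x → λχ ((a * (1# + s)) * x + (a * (1# + s) * s ⁻¹) * x ⁻¹)))
    ∑-sign-d≡∑*∑* = begin
      ∑ sign (d a)                                                   ≡⟨ ∑-map sign (dEntry a) pairs ⟩
      ∑ (sign ∘ dEntry a) pairs                                      ≡⟨ ∑-pairs _ _ entry ⟩
      ∑* (λ x → ∑* (λ y → λχ (a * (x + y + x ⁻¹ + y ⁻¹))))           ≡⟨ ∑*-shear _ ⟩
      ∑* (λ s → ∑* (λ x → λχ (a * (x + x * s + x ⁻¹ + (x * s) ⁻¹))))
        ≡⟨ ∑-cong units (λ s∈ → ∑-cong units (λ {x} _ → cong λχ (row x (∈-units⁻ s∈)))) ⟩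
      ∑* (λ s → ∑* (λ x → λχ ((a * (1# + s)) * x + (a * (1# + s) * s ⁻¹) * x ⁻¹))) ∎
      where
      entry : ∀ {x y} (x≢0 : x ≢ 0#) (y≢0 : y ≢ 0#) →
              sign (dEntry a ((x , x≢0) , (y , y≢0))) ≡ λχ (a * (x + y + x ⁻¹ + y ⁻¹))
      entry x≢0 y≢0 = trans (cong (λ z → sign (tr (a * z))) (cong₂ (λ u v → _ + _ + u + v) (inv≡⁻¹ x≢0) (inv≡⁻¹ y≢0)))
                            (sym (λχ≡sign∘tr _))
      row : ∀ x {s} → s ≢ 0# → a * (x + x * s + x ⁻¹ + (x * s) ⁻¹) ≡ (a * (1# + s)) * x + (a * (1# + s) * s ⁻¹) * x ⁻¹
      row x {s} s≢0 = begin
        a * (x + x * s + x ⁻¹ + (x * s) ⁻¹)                  ≡⟨ cong₂ (λ u v → a * (x + x * s + u + v))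
                                                                  (sym (trans (cong (x ⁻¹ *_) (⁻¹-inverseʳ s≢0)) (*-identityʳ _)))
                                                                  (⁻¹-distrib-* x s) ⟩
        a * (x + x * s + x ⁻¹ * (s * s ⁻¹) + x ⁻¹ * s ⁻¹)    ≡⟨ solve 5 (λ a x s x' s' → a :* (x :+ x :* s :+ x' :* (s :* s') :+ x' :* s')
                                                                          := (a :* (con 1 :+ s)) :* x :+ (a :* (con 1 :+ s) :* s') :* x')
                                                                  refl a x s (x ⁻¹) (s ⁻¹) ⟩
        (a * (1# + s)) * x + (a * (1# + s) * s ⁻¹) * x ⁻¹    ∎

    K₂≡∑*∑* : K₂ a ≡ ∑* (λ s → ∑* (λ x → λχ ((1# + s) * x + (a * s ⁻¹) * (x * x) ⁻¹)))
    K₂≡∑*∑* = begin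
      K₂ a                                                           ≡⟨ ∑-pairs _ _ term ⟩
      ∑* (λ x → ∑* (λ y → λχ (x + y + a * x ⁻¹ * y ⁻¹)))             ≡⟨ ∑*-shear _ ⟩
      ∑* (λ s → ∑* (λ x → λχ (x + x * s + a * x ⁻¹ * (x * s) ⁻¹)))
        ≡⟨ ∑-cong units (λ {s} _ → ∑-cong units (λ {x} _ → cong λχ (row x s))) ⟩
      ∑* (λ s → ∑* (λ x → λχ ((1# + s) * x + (a * s ⁻¹) * (x * x) ⁻¹))) ∎
      where
      term : ∀ {x y} (x≢0 : x ≢ 0#) (y≢0 : y ≢ 0#) →
             λχ (x + y + a * inv x x≢0 * inv y y≢0) ≡ λχ (x + y + a * x ⁻¹ * y ⁻¹)
      term x≢0 y≢0 = cong λχ (cong₂ (λ u v → _ + _ + a * u * v) (inv≡⁻¹ x≢0) (inv≡⁻¹ y≢0))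
      row : ∀ x s → x + x * s + a * x ⁻¹ * (x * s) ⁻¹ ≡ (1# + s) * x + (a * s ⁻¹) * (x * x) ⁻¹
      row x s = begin
        x + x * s + a * x ⁻¹ * (x * s) ⁻¹          ≡⟨ cong (λ z → x + x * s + a * x ⁻¹ * z) (⁻¹-distrib-* x s) ⟩
        x + x * s + a * x ⁻¹ * (x ⁻¹ * s ⁻¹)       ≡⟨ solve 5 (λ a x s x' s' → x :+ x :* s :+ a :* x' :* (x' :* s')
                                                                  := (con 1 :+ s) :* x :+ (a :* s') :* (x' :* x'))
                                                          refl a x s (x ⁻¹) (s ⁻¹) ⟩
        (1# + s) * x + (a * s ⁻¹) * (x ⁻¹ * x ⁻¹)  ≡⟨ cong (λ z → (1# + s) * x + (a * s ⁻¹) * z) (sym (⁻¹-distrib-* x x)) ⟩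
        (1# + s) * x + (a * s ⁻¹) * (x * x) ⁻¹     ∎

    K₂≡∑*K₁ : K₂ a ≡ ∑* (λ s → K₁ (a * κ s))
    K₂≡∑*K₁ = trans K₂≡∑*∑* (∑-cong units λ {s} s∈ →
      trans (∑*-λχ-linear+inverse² (1# + s) (*-≢0 a≢0 (⁻¹-≢0 (∈-units⁻ s∈))))
            (cong K₁ (solve 3 (λ a u s' → u :* u :* (a :* s') := a :* (u :* u :* s')) refl a (1# + s) (s ⁻¹))))

    ∑*K₁[a*a*κ]≡∑*K₁[a*κ] : ∑* (λ s → K₁ (a * a * κ s)) ≡ ∑* (λ s → K₁ (a * κ s))
    ∑*K₁[a*a*κ]≡∑*K₁[a*κ] = begin
      ∑* (λ s → K₁ (a * a * κ s))                   ≡⟨ sym (∑*-square (λ s → K₁ (a * a * κ s))) ⟩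
      ∑* (λ t → K₁ (a * a * κ (t * t)))             ≡⟨ ∑-cong units (λ {t} _ → cong K₁ (trans (cong (a * a *_) (κ-square t))
                                                        (solve 2 (λ a k → a :* a :* (k :* k) := (a :* k) :* (a :* k)) refl a (κ t)))) ⟩
      ∑* (λ t → K₁ ((a * κ t) * (a * κ t)))         ≡⟨ ∑-cong units (λ {t} _ → K₁-square (a * κ t)) ⟩
      ∑* (λ t → K₁ (a * κ t))                       ∎

    ∑-sign-d≡∑*K₁ : ∑ sign (d a) ≡ ∑* (λ s → K₁ (a * κ s)) ℤ.+ (ℤ.+ N ℤ.+ 1ℤ)
    ∑-sign-d≡∑*K₁ = begin
      ∑ sign (d a)
        ≡⟨ ∑-sign-d≡∑*∑* ⟩
      ∑* P
        ≡⟨ ∑-agree-except _≟_ P (λ s → K₁ (a * a * κ s)) units-unique (∈-units 1≢0) P≡K₁ ⟩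
      ∑* (λ s → K₁ (a * a * κ s)) ℤ.+ (P 1# ℤ.- K₁ (a * a * κ 1#))
        ≡⟨ cong₂ ℤ._+_ ∑*K₁[a*a*κ]≡∑*K₁[a*κ] (cong₂ ℤ._-_ P-1 K₁[a*a*κ1]≡-1) ⟩
      ∑* (λ s → K₁ (a * κ s)) ℤ.+ (ℤ.+ N ℤ.+ 1ℤ)
        ∎
      where
      P : Carrier → ℤ
      P s = ∑* (λ x → λχ ((a * (1# + s)) * x + (a * (1# + s) * s ⁻¹) * x ⁻¹))
      1≢0 : 1# ≢ 0#
      1≢0 1≡0 = 0≢1 (sym 1≡0)
      K₁[a*a*κ1]≡-1 : K₁ (a * a * κ 1#) ≡ -1ℤ
      K₁[a*a*κ1]≡-1 = trans (cong (λ z → K₁ (a * a * z)) κ-1) (trans (cong K₁ (zeroʳ _)) K₁-0)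
      P≡K₁ : ∀ {s} → s ∈ units → s ≢ 1# → P s ≡ K₁ (a * a * κ s)
      P≡K₁ {s} s∈ s≢1 = trans (∑*-λχ-linear+inverse (a * (1# + s)) (*-≢0 (*-≢0 a≢0 1+s≢0) (⁻¹-≢0 (∈-units⁻ s∈))))
        (cong K₁ (solve 3 (λ a u s' → (a :* u) :* (a :* u :* s') := a :* a :* (u :* u :* s')) refl a (1# + s) (s ⁻¹)))
        where
        1+s≢0 : 1# + s ≢ 0#
        1+s≢0 1+s≡0 = s≢1 (sym (x+y≡0⇒x≡y 1+s≡0))
      P-1 : P 1# ≡ ℤ.+ N
      P-1 = trans (∑-cong units (λ {x} _ → trans (cong λχ (vanishes x)) λχ-0)) (trans (∑-const 1ℤ units) (ℤ.*-identityʳ _))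
        where
        vanishes : ∀ x → (a * (1# + 1#)) * x + (a * (1# + 1#) * 1# ⁻¹) * x ⁻¹ ≡ 0#
        vanishes x = trans (cong (λ z → (a * z) * x + (a * z * 1# ⁻¹) * x ⁻¹) 1+1≡0)
          (solve 4 (λ a x y w → (a :* con 0) :* x :+ (a :* con 0 :* y) :* w := con 0) refl a x (1# ⁻¹) (x ⁻¹))

    ∑-sign-d≡K₂ : ∑ sign (d a) ≡ K₂ a ℤ.+ (ℤ.+ N ℤ.+ 1ℤ)
    ∑-sign-d≡K₂ = trans ∑-sign-d≡∑*K₁ (cong (ℤ._+ (ℤ.+ N ℤ.+ 1ℤ)) (sym K₂≡∑*K₁))

open import Data.Integer using (+_; _+_; _-_; _*_)

corollary23 : (r : ℕ) (F : FiniteField r) (a : FiniteField.Carrier F) →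
    ¬ (a ≡ FiniteField.0# F) →
    + 2 * + FiniteField.weight F (FiniteField.d F a)
      ≡ + (2 ^ r) * + (2 ^ r) - + 3 * + (2 ^ r) + + 1 - FiniteField.K₂ F a
corollary23 r F a a≢0 = begin
  + 2 * + weight (d a)
    ≡⟨ 2*weight≡length-∑sign (d a) ⟩
  + length (d a) - ∑ sign (d a)
    ≡⟨ cong₂ _-_ (cong +_ (List.length-map (dEntry a) pairs)) (∑-sign-d≡K₂ a≢0) ⟩
  + length pairs - (K₂ a + (+ N + 1ℤ))
    ≡⟨ cong (_- (K₂ a + (+ N + 1ℤ))) length-pairs ⟩
  + N * + N - (K₂ a + (+ N + 1ℤ))
    ≡⟨ rearrange (+ N) (K₂ a) ⟩
  (1ℤ + + N) * (1ℤ + + N) - + 3 * (1ℤ + + N) + 1ℤ - K₂ a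
    ≡⟨ cong (λ q → q * q - + 3 * q + 1ℤ - K₂ a) (cong +_ (sym q≡1+N)) ⟩
  + (2 ^ r) * + (2 ^ r) - + 3 * + (2 ^ r) + 1ℤ - K₂ a
    ∎
  where
  open FiniteField F using (weight; d; dEntry; pairs; K₂)
  open FiniteFieldTheory F
  open ≡-Reasoning
  rearrange : ∀ n t → n * n - (t + (n + 1ℤ)) ≡ (1ℤ + n) * (1ℤ + n) - + 3 * (1ℤ + n) + 1ℤ - t
  rearrange = solve-∀
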